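{- Let $f(n)=an^{2}+bn+c$ with $a,b,c\in\mathbb{Z}$, $a$ odd and $b$ even. Suppose $b^{2}-4ac=4^{\ell}\Delta$ where $\ell$ is the largest positive integer with $4^{\ell}\mid b^2-4ac$, $\ell\geq 2$, and $\Delta\equiv m\pmod 8$ with $m\in\{2,3,5,6,7\}$. Then $(\nu_{2}(f(n)))_{n\geq 0}$ is bounded and periodic with minimal period length $2^{\ell}$. Moreover, letting $a^{ -1}$ denote an integer inverse of $a$ modulo $2^{\ell}$, for $n\in\mathbb{N}$: \[ \nu_{2}(f(n))=\begin{cases} 0,& \text{if } n\equiv a^{ -1}\left(1-\tfrac{b}{2}\right)\pmod 2;\\ 2(i-1),& \text{if } n\equiv a^{ -1}\left(2^{i-1}-\tfrac{b}{2}\right)\pmod{2^{i}} \text{ with } 2\leq i<\ell;\\ 2(\ell-1),& \text{if } n\equiv a^{ -1}\left(2^{\ell-1}-\tfrac{b}{2}\right)\pmod{2^{\ell}} \text{ and } m\in\{2,6\};\\ 2\ell-1,& \text{if } n\equiv a^{ -1}\left(2^{\ell-1}-\tfrac{b}{2}\right)\pmod{2^{\ell}} \text{ and } m\in\{3,7\};\\ 2\ell,& \text{if } n\equiv a^{ -1}\left(2^{\ell-1}-\tfrac{b}{2}\right)\pmod{2^{\ell}} \text{ and } m=5;\\ 2\ell-1,& \text{if } n\equiv a^{ -1}\left(2^{\ell}-\tfrac{b}{2}\right)\pmod{2^{\ell}} \text{ and } m\in\{2,6\};\\ 2(\ell-1),& \text{if } n\equiv a^{ -1}\left(2^{\ell}-\tfrac{b}{2}\right)\pmod{2^{\ell}}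 \text{ and } m\in\{3,5,7\}. \end{cases} \]
   Context: $\mathbb{N}=\{0,1,2,\ldots\}$. For an integer $x\neq 0$, $\nu_2(x)$ is the exponent of the highest power of $2$ dividing $x$, and $\nu_2(0)=+\infty$. -}

module Defs where

open import Data.Nat using (ℕ; suc; _^_)
open import Data.Integer using (ℤ; +_; _+_; _*_; _-_)
open import Data.Integer.Divisibility using (_∣_)
open import Data.Product using (_×_)
open import Relation.Nullary using (¬_)

quad : ℤ → ℤ → ℤ → ℤ → ℤ
quad a b c x = a * x * x + b * x + c

infix 4 _≡_[mod_]
_≡_[mod_] : ℤ → ℤ → ℕ → Set
x ≡ y [mod k ] = (+ k) ∣ (x - y)

-- ν₂(x) = k : 2^k divides x but 2^(k+1) does not (forces x ≠ 0)
Val2 : ℤ → ℕ → Set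
Val2 x k = ((+ (2 ^ k)) ∣ x) × ¬ ((+ (2 ^ suc k)) ∣ x)

{-# OPTIONS --safe #-}
module Submission where

-- Write b = 2h and p = ℓ − 1. Then h² − ac = 4^p Δ, so a·f(n) = y² − 4^p Δ with y = an + h,
-- and ν₂ f(n) = ν₂ (y² − 4^p Δ) because a is odd. Everything is decided by ν₂ y: if ν₂ y = j < p
-- the value is 2j; if y = 2^p u with u odd, then u² ≡ 1 (mod 8) gives 2p + ν₂ (1 − Δ); if 2^(p+1) ∣ y
-- it is 2p + ν₂ Δ. The congruence Δ ≡ m (mod 8) makes ν₂ (1 − Δ) < 3 and ν₂ Δ < 2, and the two differ.
-- The case only depends on y mod 2^ℓ, which gives the period 2^ℓ. As a is odd, exactly one residue
-- of n mod 2^ℓ falls into the last case, whose value occurs nowhere else, so no shorter period exists.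

open import Defs
open import Data.Nat using (ℕ; suc; _^_; _≤_; _<_; _∸_) renaming (_+_ to _+ℕ_; _*_ to _*ℕ_)
open import Data.Integer using (ℤ; +_; _+_; _*_; _-_)
open import Data.Integer.Divisibility using (_∣_)
open import Data.Product using (Σ; _×_; ∃)
open import Data.Sum using (_⊎_)
open import Relation.Nullary using (¬_)
open import Relation.Binary.PropositionalEquality using (_≡_)

open import Data.Nat using (zero; z≤n; s≤s; >-nonZero)
import Data.Nat.Properties as ℕₚ
import Data.Nat.Divisibility as ℕᵈ
open import Data.Nat.Primality using (euclidsLemma; prime[2])
open import Data.Integer using (-_; ∣_∣)
import Data.Integer.Properties as ℤₚ
import Data.Integer.Divisibility.Signed as Signed
open import Data.Integer.DivMod using (_%ℕ_; _/ℕ_; n%ℕd<d; a≡a%ℕn+[a/ℕn]*n)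
open import Data.Integer.Tactic.RingSolver using (solve-∀)
open import Data.Product using (_,_; proj₁; proj₂; ∃-syntax)
open import Data.Sum using (inj₁; inj₂; [_,_]; [_,_]′)
open import Data.Empty using (⊥-elim)
open import Relation.Nullary using (Dec; yes; no; ¬?; _×-dec_)
open import Relation.Nullary.Decidable using (from-yes)
open import Relation.Binary.PropositionalEquality
  using (refl; sym; trans; cong; cong₂; subst; subst₂; _≢_; module ≡-Reasoning)
import Data.Integer.Divisibility as Unsigned
open import Relation.Binary.Definitions using (tri<; tri≈; tri>)

2^_ : ℕ → ℤ
2^ k = + (2 ^ k)

2^-suc : ∀ k → 2^ suc k ≡ + 2 * 2^ k
2^-suc k = ℤₚ.pos-* 2 (2 ^ k)

2^-suc′ : ∀ k → 2^ suc k ≡ 2^ k * + 2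
2^-suc′ k = trans (2^-suc k) (ℤₚ.*-comm (+ 2) (2^ k))

2^-+ : ∀ i j → 2^ (i +ℕ j) ≡ 2^ i * 2^ j
2^-+ i j = trans (cong +_ (ℕₚ.^-distribˡ-+-* 2 i j)) (ℤₚ.pos-* (2 ^ i) (2 ^ j))

2^-double : ∀ k → 2^ (2 *ℕ k) ≡ 2^ k * 2^ k
2^-double k = trans (cong (λ j → 2^ (k +ℕ j)) (ℕₚ.+-identityʳ k)) (2^-+ k k)

4^≡2^*2^ : ∀ k → + (4 ^ k) ≡ 2^ k * 2^ k
4^≡2^*2^ k = trans (cong +_ (ℕₚ.^-*-assoc 2 2 k)) (2^-double k)

2^∣2^ : ∀ {i j} → i ≤ j → 2^ i ∣ 2^ j
2^∣2^ {i} i≤j with ℕₚ.m≤n⇒∃[o]m+o≡n i≤j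
... | o , refl = ℕᵈ.divides (2 ^ o) (trans (ℕₚ.^-distribˡ-+-* 2 i o) (ℕₚ.*-comm (2 ^ i) (2 ^ o)))

∣m*n : ∀ m n → m ∣ m * n
∣m*n m n = subst (∣ m ∣ ℕᵈ.∣_) (sym (ℤₚ.abs-* m n)) (ℕᵈ.m∣m*n ∣ n ∣)

∣-intro : ∀ {d x} z → x ≡ z * d → d ∣ x
∣-intro {d} {x} z x≡zd = Signed.∣⇒∣ᵤ {d} {x} (Signed.divides z x≡zd)

∣n⇒∣m*n : ∀ m {d n} → d ∣ n → d ∣ m * n
∣n⇒∣m*n m {d} {n} d∣n = Signed.∣⇒∣ᵤ {d} {m * n} (Signed.∣n⇒∣m*n m (Signed.∣ᵤ⇒∣ {d} {n} d∣n))

∣m∣n⇒∣m-n : ∀ {d m n} → d ∣ m → d ∣ n → d ∣ m - n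
∣m∣n⇒∣m-n {d} {m} {n} d∣m d∣n =
  Signed.∣⇒∣ᵤ {d} {m - n} (Signed.∣m∣n⇒∣m-n (Signed.∣ᵤ⇒∣ {d} {m} d∣m) (Signed.∣ᵤ⇒∣ {d} {n} d∣n))

≡-mod-intro : ∀ {x y n} z → x - y ≡ + n * z → x ≡ y [mod n ]
≡-mod-intro {n = n} z eq = ∣-intro z (trans eq (ℤₚ.*-comm (+ n) z))

≡-mod-refl : ∀ {x n} → x ≡ x [mod n ]
≡-mod-refl {x} {n} = ≡-mod-intro {x} {x} (+ 0) (trans (ℤₚ.+-inverseʳ x) (sym (ℤₚ.*-zeroʳ (+ n))))

≡-mod-sym : ∀ {x y n} → x ≡ y [mod n ] → y ≡ x [mod n ]
≡-mod-sym {x} {y} {n} x≡y =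
  Signed.∣⇒∣ᵤ {+ n} {y - x}
    (subst (Signed._∣_ (+ n)) (swap x y) (Signed.∣m⇒∣-m (Signed.∣ᵤ⇒∣ {+ n} {x - y} x≡y)))
  where
  swap : ∀ x y → - (x - y) ≡ y - x
  swap = solve-∀

∣-resp-≡-mod : ∀ {x y n} → x ≡ y [mod n ] → + n ∣ x → + n ∣ y
∣-resp-≡-mod {x} {y} {n} x≡y n∣x = Signed.∣⇒∣ᵤ {+ n} {y} (subst (Signed._∣_ (+ n)) (cancel x y)
  (Signed.∣m∣n⇒∣m-n (Signed.∣ᵤ⇒∣ {+ n} {x} n∣x) (Signed.∣ᵤ⇒∣ {+ n} {x - y} x≡y)))
  where
  cancel : ∀ x y → x - (x - y) ≡ y
  cancel = solve-∀

linear-≡ : ∀ {a a⁻¹ x h R M} → a * a⁻¹ ≡ + 1 [mod M ] → x ≡ a⁻¹ * (R - h) [mod M ] → a * x + h ≡ R [mod M ]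
linear-≡ {a} {a⁻¹} {x} {h} {R} {M} inv x≡ = Signed.∣⇒∣ᵤ {+ M} {a * x + h - R}
  (subst (Signed._∣_ (+ M)) (split a a⁻¹ x h R)
    (Signed.∣m∣n⇒∣m+n (Signed.∣n⇒∣m*n a (Signed.∣ᵤ⇒∣ {+ M} {x - a⁻¹ * (R - h)} x≡))
                      (Signed.∣m⇒∣m*n (R - h) (Signed.∣ᵤ⇒∣ {+ M} {a * a⁻¹ - + 1} inv))))
  where
  split : ∀ a a⁻¹ x h R → a * (x - a⁻¹ * (R - h)) + (a * a⁻¹ - + 1) * (R - h) ≡ a * x + h - R
  split = solve-∀

Odd : ℤ → Set
Odd x = ¬ (+ 2 ∣ x)

parity : ∀ x → (∃[ q ] x ≡ + 2 * q) ⊎ (∃[ q ] x ≡ + 1 + + 2 * q)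
parity x with x %ℕ 2 | n%ℕd<d x 2 | a≡a%ℕn+[a/ℕn]*n x 2
... | 0           | _            | eq = inj₁ (x /ℕ 2 , trans eq (trans (ℤₚ.+-identityˡ _) (ℤₚ.*-comm (x /ℕ 2) (+ 2))))
... | 1           | _            | eq = inj₂ (x /ℕ 2 , trans eq (cong (λ z → + 1 + z) (ℤₚ.*-comm (x /ℕ 2) (+ 2))))
... | suc (suc _) | s≤s (s≤s ()) | _

odd⇒1+2* : ∀ {x} → Odd x → ∃[ q ] x ≡ + 1 + + 2 * q
odd⇒1+2* {x} x-odd with parity x
... | inj₁ (q , x≡2q) = ⊥-elim (x-odd (subst (+ 2 ∣_) (sym x≡2q) (∣m*n (+ 2) q)))
... | inj₂ r          = r

1+2*-odd : ∀ q → Odd (+ 1 + + 2 * q)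
1+2*-odd q 2∣1+2q with ℕᵈ.∣1⇒≡1 (Signed.∣⇒∣ᵤ {+ 2} {+ 1} 2∣1)
  where
  2∣1 : + 2 Signed.∣ + 1
  2∣1 = Signed.∣m+n∣n⇒∣m (Signed.∣ᵤ⇒∣ {+ 2} {+ 1 + + 2 * q} 2∣1+2q)
                         (Signed.∣ᵤ⇒∣ {+ 2} {+ 2 * q} (∣m*n (+ 2) q))
... | ()

odd-* : ∀ {x y} → Odd x → Odd y → Odd (x * y)
odd-* {x} {y} x-odd y-odd 2∣xy =
  [ x-odd , y-odd ] (euclidsLemma ∣ x ∣ ∣ y ∣ prime[2] (subst (2 ℕᵈ.∣_) (ℤₚ.abs-* x y) 2∣xy))

odd-square : ∀ {u} → Odd u → + 1 ≡ u * u [mod 8 ]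
odd-square {u} u-odd with odd⇒1+2* {u} u-odd
... | q , refl with parity q
...   | inj₁ (r , refl) = ≡-mod-intro {+ 1} {u * u} (- (r + + 2 * r * r)) (even r)
  where
  even : ∀ r → + 1 - (+ 1 + + 2 * (+ 2 * r)) * (+ 1 + + 2 * (+ 2 * r)) ≡ + 8 * (- (r + + 2 * r * r))
  even = solve-∀
...   | inj₂ (r , refl) = ≡-mod-intro {+ 1} {u * u} (- (+ 1 + + 3 * r + + 2 * r * r)) (odd r)
  where
  odd : ∀ r → + 1 - (+ 1 + + 2 * (+ 1 + + 2 * r)) * (+ 1 + + 2 * (+ 1 + + 2 * r)) ≡ + 8 * (- (+ 1 + + 3 * r + + 2 * r * r))
  odd = solve-∀

2^∣-cancel-odd : ∀ {a} → Odd a → ∀ k {x} → 2^ k ∣ a * x → 2^ k ∣ x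
2^∣-cancel-odd a-odd zero _ = ℕᵈ.1∣ _
2^∣-cancel-odd {a} a-odd (suc k) {x} 2^k2∣ax with parity x
... | inj₂ (q , x≡1+2q) =
  ⊥-elim (odd-* {a} {x} a-odd (subst Odd (sym x≡1+2q) (1+2*-odd q))
                             (ℕᵈ.∣-trans (2^∣2^ {1} {suc k} (s≤s z≤n)) 2^k2∣ax))
... | inj₁ (q , refl) =
  subst (_∣ + 2 * q) (sym (2^-suc k)) (Unsigned.*-monoʳ-∣ (+ 2) {2^ k} {q} (2^∣-cancel-odd {a} a-odd k {q} 2^k∣aq))
  where
  swap : ∀ a q → a * (+ 2 * q) ≡ + 2 * (a * q)
  swap = solve-∀
  2^k∣aq : 2^ k ∣ a * q
  2^k∣aq = Unsigned.*-cancelˡ-∣ (+ 2) {2^ k} {a * q} (subst₂ _∣_ (2^-suc k) (swap a q) 2^k2∣ax)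

odd-linear-solvable : ∀ {a} → Odd a → ∀ k h → ∃[ n ] 2^ k ∣ a * + n + h
odd-linear-solvable a-odd zero h = 0 , ℕᵈ.1∣ _
odd-linear-solvable {a} a-odd (suc k) h with odd-linear-solvable {a} a-odd k h
... | n , 2^k∣y = lift (Signed.∣ᵤ⇒∣ {2^ k} {a * + n + h} 2^k∣y) (odd⇒1+2* {a} a-odd)
  where
  shift : ∀ a n K h → a * (n + K) + h ≡ (a * n + h) + a * K
  shift = solve-∀
  even : ∀ q K → q * (+ 2 * K) ≡ (+ 2 * q) * K
  even = solve-∀
  odd : ∀ q r K → (+ 1 + + 2 * q) * K + (+ 1 + + 2 * r) * K ≡ (+ 1 + q + r) * (+ 2 * K)
  odd = solve-∀
  -- If the cofactor w is odd, moving n to n + 2^k adds the odd multiple a·2^k and makes it even.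
  lift : 2^ k Signed.∣ a * + n + h → (∃[ r ] a ≡ + 1 + + 2 * r) → ∃[ n ] 2^ suc k ∣ a * + n + h
  lift (Signed.divides w y≡w2^k) (r , a≡1+2r) with parity w
  ... | inj₁ (q , refl) = n , ∣-intro q (trans y≡w2^k (sym (trans (cong (q *_) (2^-suc k)) (even q (2^ k)))))
  ... | inj₂ (q , refl) = n +ℕ 2 ^ k , ∣-intro (+ 1 + q + r) (begin
    a * + (n +ℕ 2 ^ k) + h              ≡⟨ cong (λ z → a * z + h) (ℤₚ.pos-+ n (2 ^ k)) ⟩
    a * (+ n + 2^ k) + h                ≡⟨ shift a (+ n) (2^ k) h ⟩
    (a * + n + h) + a * 2^ k            ≡⟨ cong₂ (λ u v → u + v * 2^ k) y≡w2^k a≡1+2r ⟩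
    (+ 1 + + 2 * q) * 2^ k + (+ 1 + + 2 * r) * 2^ k ≡⟨ odd q r (2^ k) ⟩
    (+ 1 + q + r) * (+ 2 * 2^ k)        ≡⟨ cong ((+ 1 + q + r) *_) (sym (2^-suc k)) ⟩
    (+ 1 + q + r) * 2^ suc k            ∎)
    where open ≡-Reasoning

Val2? : ∀ x k → Dec (Val2 x k)
Val2? x k = (2 ^ k ℕᵈ.∣? ∣ x ∣) ×-dec ¬? (2 ^ suc k ℕᵈ.∣? ∣ x ∣)

Val2-2^* : ∀ k {w} → Odd w → Val2 (2^ k * w) k
Val2-2^* k {w} w-odd = ∣m*n (2^ k) w , λ 2^k2∣2^kw →
  w-odd (Unsigned.*-cancelˡ-∣ (2^ k) {{ℕₚ.m^n≢0 2 k}} (subst (_∣ 2^ k * w) (2^-suc′ k) 2^k2∣2^kw))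

Val2-2^ : ∀ k → Val2 (2^ k) k
Val2-2^ k = subst (λ x → Val2 x k) (ℤₚ.*-identityʳ (2^ k)) (Val2-2^* k (1+2*-odd (+ 0)))

Val2-2^*2^ : ∀ p → Val2 (2^ p * 2^ p) (2 *ℕ p)
Val2-2^*2^ p = subst (λ x → Val2 x (2 *ℕ p)) (2^-double p) (Val2-2^ (2 *ℕ p))

Val2⇒2^* : ∀ {x k} → Val2 x k → ∃[ w ] Odd w × x ≡ 2^ k * w
Val2⇒2^* {x} {k} (2^k∣x , 2^k2∤x) = decompose (Signed.∣ᵤ⇒∣ {2^ k} {x} 2^k∣x)
  where
  decompose : 2^ k Signed.∣ x → ∃[ w ] Odd w × x ≡ 2^ k * w
  decompose (Signed.divides w x≡w2^k) = w , w-odd , x≡2^kw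
    where
    x≡2^kw : x ≡ 2^ k * w
    x≡2^kw = trans x≡w2^k (ℤₚ.*-comm w (2^ k))
    w-odd : Odd w
    w-odd 2∣w = 2^k2∤x (subst₂ _∣_ (sym (2^-suc′ k)) (sym x≡2^kw) (Unsigned.*-monoʳ-∣ (2^ k) 2∣w))

Val2⇒¬2^∣ : ∀ {x j N} → Val2 x j → j < N → ¬ (2^ N ∣ x)
Val2⇒¬2^∣ (_ , 2^j2∤x) j<N 2^N∣x = 2^j2∤x (ℕᵈ.∣-trans (2^∣2^ j<N) 2^N∣x)

Val2-unique : ∀ {x j k} → Val2 x j → Val2 x k → j ≡ k
Val2-unique {x} {j} {k} vj vk with ℕₚ.<-cmp j k
... | tri< j<k _ _ = ⊥-elim (Val2⇒¬2^∣ {x} vj j<k (proj₁ vk))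
... | tri≈ _ j≡k _ = j≡k
... | tri> _ _ k<j = ⊥-elim (Val2⇒¬2^∣ {x} vk k<j (proj₁ vj))

Val2-* : ∀ {x y i j} → Val2 x i → Val2 y j → Val2 (x * y) (i +ℕ j)
Val2-* {x} {y} {i} {j} vx vy with Val2⇒2^* {x} {i} vx | Val2⇒2^* {y} {j} vy
... | w , w-odd , x≡ | w′ , w′-odd , y≡ =
  subst (λ z → Val2 z (i +ℕ j)) (sym xy≡) (Val2-2^* (i +ℕ j) (odd-* {w} {w′} w-odd w′-odd))
  where
  interchange : ∀ a b c d → (a * c) * (b * d) ≡ (a * b) * (c * d)
  interchange = solve-∀
  xy≡ : x * y ≡ 2^ (i +ℕ j) * (w * w′)
  xy≡ = trans (cong₂ _*_ x≡ y≡) (trans (interchange (2^ i) (2^ j) w w′) (cong (_* (w * w′)) (sym (2^-+ i j))))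

Val2-square : ∀ {x k} → Val2 x k → Val2 (x * x) (2 *ℕ k)
Val2-square {x} {k} vx = subst (Val2 (x * x)) (cong (k +ℕ_) (sym (ℕₚ.+-identityʳ k))) (Val2-* {x} {x} {k} {k} vx vx)

Val2-neg : ∀ {x k} → Val2 x k → Val2 (- x) k
Val2-neg {x} {k} = subst (λ n → (2 ^ k ℕᵈ.∣ n) × ¬ (2 ^ suc k ℕᵈ.∣ n)) (sym (ℤₚ.∣-i∣≡∣i∣ x))

Val2-resp-≡ : ∀ {x y j N} → Val2 x j → j < N → x ≡ y [mod 2 ^ N ] → Val2 y j
Val2-resp-≡ {x} {y} {j} (2^j∣x , 2^j2∤x) j<N x≡y =
  ∣-resp-≡-mod {x} {y} (ℕᵈ.∣-trans (2^∣2^ (ℕₚ.n≤1+n j)) x≡y′) 2^j∣x ,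
  λ 2^j2∣y → 2^j2∤x (∣-resp-≡-mod {y} {x} (≡-mod-sym {x} {y} x≡y′) 2^j2∣y)
  where
  x≡y′ : x ≡ y [mod 2 ^ suc j ]
  x≡y′ = ℕᵈ.∣-trans (2^∣2^ j<N) x≡y

Val2-1-resp-≡ : ∀ {x y k N} → Val2 (+ 1 - x) k → k < N → x ≡ y [mod 2 ^ N ] → Val2 (+ 1 - y) k
Val2-1-resp-≡ {x} {y} {k} {N} v k<N x≡y = Val2-resp-≡ {+ 1 - x} {+ 1 - y} v k<N
  (subst (λ z → + (2 ^ N) ∣ z) (swap x y) (≡-mod-sym {x} {y} x≡y))
  where
  swap : ∀ x y → y - x ≡ (+ 1 - x) - (+ 1 - y)
  swap = solve-∀

Val2-cancel-odd : ∀ {a x k} → Odd a → Val2 (a * x) k → Val2 x k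
Val2-cancel-odd {a} {x} {k} a-odd (2^k∣ax , 2^k2∤ax) =
  2^∣-cancel-odd {a} a-odd k {x} 2^k∣ax , λ 2^k2∣x → 2^k2∤ax (∣n⇒∣m*n a {2^ suc k} {x} 2^k2∣x)

Val2-or-2^∣ : ∀ N x → (∃[ j ] j < N × Val2 x j) ⊎ 2^ N ∣ x
Val2-or-2^∣ zero x = inj₂ (ℕᵈ.1∣ _)
Val2-or-2^∣ (suc N) x with Val2-or-2^∣ N x
... | inj₁ (j , j<N , v) = inj₁ (j , ℕₚ.m<n⇒m<1+n j<N , v)
... | inj₂ 2^N∣x with 2 ^ suc N ℕᵈ.∣? ∣ x ∣
...   | yes 2^N2∣x = inj₂ 2^N2∣x
...   | no 2^N2∤x  = inj₁ (N , ℕₚ.n<1+n N , 2^N∣x , 2^N2∤x)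

Val2-square-sub-below : ∀ {Y j p} Δ → Val2 Y j → j < p → Val2 (Y * Y - 2^ p * 2^ p * Δ) (2 *ℕ j)
Val2-square-sub-below {Y} {j} {p} Δ vY j<p =
  Val2-resp-≡ {Y * Y} {Y * Y - 2^ p * 2^ p * Δ} (Val2-square {Y} {j} vY) (ℕₚ.*-monoʳ-< 2 j<p)
    (≡-mod-intro {Y * Y} {Y * Y - 2^ p * 2^ p * Δ} Δ
      (trans (cancel Y (2^ p * 2^ p) Δ) (cong (_* Δ) (sym (2^-double p)))))
  where
  cancel : ∀ Y P Δ → Y * Y - (Y * Y - P * Δ) ≡ P * Δ
  cancel = solve-∀

Val2-square-sub-at : ∀ {Y p k} Δ → Val2 Y p → Val2 (+ 1 - Δ) k → k < 3 →
                     Val2 (Y * Y - 2^ p * 2^ p * Δ) (k +ℕ 2 *ℕ p)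
Val2-square-sub-at {Y} {p} {k} Δ vY v1-Δ k<3 with Val2⇒2^* {Y} {p} vY
... | u , u-odd , Y≡2^pu = subst (λ x → Val2 x (k +ℕ 2 *ℕ p)) (sym factor)
  (Val2-* {u * u - Δ} {2^ p * 2^ p} {k} {2 *ℕ p} v-Δ (Val2-2^*2^ p))
  where
  shift : ∀ u Δ → (+ 1 - Δ) - (u * u - Δ) ≡ + 1 - u * u
  shift = solve-∀
  pull : ∀ P u Δ → (P * u) * (P * u) - P * P * Δ ≡ (u * u - Δ) * (P * P)
  pull = solve-∀
  v-Δ : Val2 (u * u - Δ) k
  v-Δ = Val2-resp-≡ {+ 1 - Δ} {u * u - Δ} v1-Δ k<3 (subst (λ z → + 8 ∣ z) (sym (shift u Δ)) (odd-square {u} u-odd))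
  factor : Y * Y - 2^ p * 2^ p * Δ ≡ (u * u - Δ) * (2^ p * 2^ p)
  factor = trans (cong (λ y → y * y - 2^ p * 2^ p * Δ) Y≡2^pu) (pull (2^ p) u Δ)

Val2-square-sub-above : ∀ {Y p k} Δ → 2^ suc p ∣ Y → Val2 Δ k → k < 2 →
                        Val2 (Y * Y - 2^ p * 2^ p * Δ) (k +ℕ 2 *ℕ p)
Val2-square-sub-above {Y} {p} {k} Δ 2^p2∣Y vΔ k<2 with Signed.∣ᵤ⇒∣ {2^ suc p} {Y} 2^p2∣Y
... | Signed.divides t Y≡t2^p2 = subst (λ x → Val2 x (k +ℕ 2 *ℕ p)) (sym factor)
  (Val2-* {+ 4 * t * t - Δ} {2^ p * 2^ p} {k} {2 *ℕ p} v4tt-Δ (Val2-2^*2^ p))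
  where
  shift : ∀ t Δ → - Δ - (+ 4 * t * t - Δ) ≡ + 4 * (- (t * t))
  shift = solve-∀
  pull : ∀ P t Δ → (t * (+ 2 * P)) * (t * (+ 2 * P)) - P * P * Δ ≡ (+ 4 * t * t - Δ) * (P * P)
  pull = solve-∀
  v4tt-Δ : Val2 (+ 4 * t * t - Δ) k
  v4tt-Δ = Val2-resp-≡ {(- Δ)} {+ 4 * t * t - Δ} (Val2-neg {Δ} {k} vΔ) k<2
    (≡-mod-intro {(- Δ)} {+ 4 * t * t - Δ} (- (t * t)) (shift t Δ))
  factor : Y * Y - 2^ p * 2^ p * Δ ≡ (+ 4 * t * t - Δ) * (2^ p * 2^ p)
  factor = trans (cong (λ y → y * y - 2^ p * 2^ p * Δ) (trans Y≡t2^p2 (cong (t *_) (2^-suc p)))) (pull (2^ p) t Δ)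

-- The three cases for Y = an + h; weight kₘ kₜ is ν₂ f(n) when kₘ = ν₂ (1 − Δ) and kₜ = ν₂ Δ.
data Position (p : ℕ) (Y : ℤ) : Set where
  below : ∀ {j} → j < p → Val2 Y j → Position p Y
  at    : Val2 Y p → Position p Y
  above : 2^ suc p ∣ Y → Position p Y

position : ∀ p Y → Position p Y
position p Y with Val2-or-2^∣ (suc p) Y
... | inj₂ 2^p2∣Y = above 2^p2∣Y
... | inj₁ (j , j<1+p , v) with ℕₚ.m<1+n⇒m<n∨m≡n j<1+p
...   | inj₁ j<p  = below j<p v
...   | inj₂ refl = at v

weight : ∀ {p Y} (kₘ kₜ : ℕ) → Position p Y → ℕ
weight     kₘ kₜ (below {j} _ _) = 2 *ℕ j
weight {p} kₘ kₜ (at _)          = kₘ +ℕ 2 *ℕ p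
weight {p} kₘ kₜ (above _)       = kₜ +ℕ 2 *ℕ p

weight-resp-≡ : ∀ {p Y Y′} kₘ kₜ → Y ≡ Y′ [mod 2 ^ suc p ] →
                (π : Position p Y) (π′ : Position p Y′) → weight kₘ kₜ π ≡ weight kₘ kₜ π′
weight-resp-≡ {p} {Y} {Y′} kₘ kₜ Y≡Y′ = compare
  where
  transport : ∀ {j} → j ≤ p → Val2 Y j → Val2 Y′ j
  transport j≤p v = Val2-resp-≡ {Y} {Y′} v (s≤s j≤p) Y≡Y′
  2^p2∣Y′ : 2^ suc p ∣ Y → 2^ suc p ∣ Y′
  2^p2∣Y′ = ∣-resp-≡-mod {Y} {Y′} Y≡Y′
  compare : (π : Position p Y) (π′ : Position p Y′) → weight kₘ kₜ π ≡ weight kₘ kₜ π′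
  compare (below {j} j<p v) (below {j′} _ v′) =
    cong (2 *ℕ_) (Val2-unique {Y′} {j} {j′} (transport (ℕₚ.<⇒≤ j<p) v) v′)
  compare (below j<p v) (at v′)      = ⊥-elim (ℕₚ.<-irrefl (Val2-unique {Y′} (transport (ℕₚ.<⇒≤ j<p) v) v′) j<p)
  compare (below j<p v) (above d′)   = ⊥-elim (Val2⇒¬2^∣ {Y′} (transport (ℕₚ.<⇒≤ j<p) v) (ℕₚ.m<n⇒m<1+n j<p) d′)
  compare (at v) (below j′<p v′)     = ⊥-elim (ℕₚ.<-irrefl (Val2-unique {Y′} v′ (transport ℕₚ.≤-refl v)) j′<p)
  compare (at v) (at v′)             = refl
  compare (at v) (above d′)          = ⊥-elim (Val2⇒¬2^∣ {Y′} (transport ℕₚ.≤-refl v) (ℕₚ.n<1+n p) d′)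
  compare (above d) (below j′<p v′)  = ⊥-elim (Val2⇒¬2^∣ {Y′} v′ (ℕₚ.m<n⇒m<1+n j′<p) (2^p2∣Y′ d))
  compare (above d) (at v′)          = ⊥-elim (Val2⇒¬2^∣ {Y′} v′ (ℕₚ.n<1+n p) (2^p2∣Y′ d))
  compare (above d) (above d′)       = refl

weight-≤ : ∀ {p Y kₘ kₜ} → kₘ ≤ 2 → kₜ ≤ 2 → (π : Position p Y) → weight kₘ kₜ π ≤ 2 +ℕ 2 *ℕ p
weight-≤ {p} kₘ≤2 kₜ≤2 (below j<p _) = ℕₚ.≤-trans (ℕₚ.*-monoʳ-≤ 2 (ℕₚ.<⇒≤ j<p)) (ℕₚ.m≤n+m (2 *ℕ p) 2)
weight-≤ {p} kₘ≤2 kₜ≤2 (at _)        = ℕₚ.+-monoˡ-≤ (2 *ℕ p) kₘ≤2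
weight-≤ {p} kₘ≤2 kₜ≤2 (above _)     = ℕₚ.+-monoˡ-≤ (2 *ℕ p) kₜ≤2

weight≡⇒above : ∀ {p Y kₘ kₜ} → kₘ ≢ kₜ → (π : Position p Y) →
                weight kₘ kₜ π ≡ kₜ +ℕ 2 *ℕ p → 2^ suc p ∣ Y
weight≡⇒above {p} {kₜ = kₜ} _ (below j<p _) eq =
  ⊥-elim (ℕₚ.<-irrefl eq (ℕₚ.<-≤-trans (ℕₚ.*-monoʳ-< 2 j<p) (ℕₚ.m≤n+m (2 *ℕ p) kₜ)))
weight≡⇒above {p} {kₘ = kₘ} {kₜ} kₘ≢kₜ (at _) eq = ⊥-elim (kₘ≢kₜ (ℕₚ.+-cancelʳ-≡ (2 *ℕ p) kₘ kₜ eq))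
weight≡⇒above _ (above d) _ = d

Val2-square-sub : ∀ {Y p kₘ kₜ} Δ → Val2 (+ 1 - Δ) kₘ → kₘ < 3 → Val2 Δ kₜ → kₜ < 2 →
                  (π : Position p Y) → Val2 (Y * Y - 2^ p * 2^ p * Δ) (weight kₘ kₜ π)
Val2-square-sub {Y} {p} Δ _ _ _ _ (below {j} j<p vY) = Val2-square-sub-below {Y} {j} {p} Δ vY j<p
Val2-square-sub {Y} {p} {kₘ} Δ v1-Δ kₘ<3 _ _ (at vY) = Val2-square-sub-at {Y} {p} {kₘ} Δ vY v1-Δ kₘ<3
Val2-square-sub {Y} {p} {_} {kₜ} Δ _ _ vΔ kₜ<2 (above 2^p2∣Y) = Val2-square-sub-above {Y} {p} {kₜ} Δ 2^p2∣Y vΔ kₜ<2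

-- ν₂ (1 − m) and ν₂ m for the admissible residues m ∈ {2, 3, 5, 6, 7}; other arguments give junk.
ν₂[1-m] : ℕ → ℕ
ν₂[1-m] 3 = 1
ν₂[1-m] 5 = 2
ν₂[1-m] 7 = 1
ν₂[1-m] _ = 0

ν₂[m] : ℕ → ℕ
ν₂[m] 2 = 1
ν₂[m] 6 = 1
ν₂[m] _ = 0

record DiscValuations (Δ : ℤ) (kₘ kₜ : ℕ) : Set where
  constructor valuations
  field
    Val2-1-Δ : Val2 (+ 1 - Δ) kₘ
    kₘ<3     : kₘ < 3
    Val2-Δ   : Val2 Δ kₜ
    kₜ<2     : kₜ < 2
    kₘ≢kₜ    : kₘ ≢ kₜ

DiscValuations-resp-≡ : ∀ {x y kₘ kₜ} → x ≡ y [mod 8 ] → DiscValuations x kₘ kₜ → DiscValuations y kₘ kₜ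
DiscValuations-resp-≡ {x} {y} x≡y (valuations v₁ kₘ<3 v₂ kₜ<2 kₘ≢kₜ) =
  valuations (Val2-1-resp-≡ {x} {y} v₁ kₘ<3 x≡y) kₘ<3
             (Val2-resp-≡ {x} {y} v₂ (ℕₚ.<-trans kₜ<2 (ℕₚ.n<1+n 2)) x≡y) kₜ<2 kₘ≢kₜ

residue-valuations : ∀ {m} → m ≡ 2 ⊎ m ≡ 3 ⊎ m ≡ 5 ⊎ m ≡ 6 ⊎ m ≡ 7 →
                     DiscValuations (+ m) (ν₂[1-m] m) (ν₂[m] m)
residue-valuations (inj₁ refl) =
  valuations (from-yes (Val2? (+ 1 - + 2) 0)) (s≤s z≤n) (from-yes (Val2? (+ 2) 1)) (s≤s (s≤s z≤n)) λ ()
residue-valuations (inj₂ (inj₁ refl)) =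
  valuations (from-yes (Val2? (+ 1 - + 3) 1)) (s≤s (s≤s z≤n)) (from-yes (Val2? (+ 3) 0)) (s≤s z≤n) λ ()
residue-valuations (inj₂ (inj₂ (inj₁ refl))) =
  valuations (from-yes (Val2? (+ 1 - + 5) 2)) (s≤s (s≤s (s≤s z≤n))) (from-yes (Val2? (+ 5) 0)) (s≤s z≤n) λ ()
residue-valuations (inj₂ (inj₂ (inj₂ (inj₁ refl)))) =
  valuations (from-yes (Val2? (+ 1 - + 6) 0)) (s≤s z≤n) (from-yes (Val2? (+ 6) 1)) (s≤s (s≤s z≤n)) λ ()
residue-valuations (inj₂ (inj₂ (inj₂ (inj₂ refl)))) =
  valuations (from-yes (Val2? (+ 1 - + 7) 1)) (s≤s (s≤s z≤n)) (from-yes (Val2? (+ 7) 0)) (s≤s z≤n) λ ()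

half-discriminant : ∀ {a b c h Δ} p → b * b - + 4 * a * c ≡ + (4 ^ suc p) * Δ → b ≡ + 2 * h →
                    h * h - a * c ≡ 2^ p * 2^ p * Δ
half-discriminant {a} {b} {c} {h} {Δ} p disc b≡2h = ℤₚ.*-cancelˡ-≡ (+ 4) (h * h - a * c) (2^ p * 2^ p * Δ) (begin
  + 4 * (h * h - a * c)          ≡⟨ expand h a c ⟩
  + 2 * h * (+ 2 * h) - + 4 * a * c ≡⟨ cong (λ b → b * b - + 4 * a * c) (sym b≡2h) ⟩
  b * b - + 4 * a * c            ≡⟨ disc ⟩
  + (4 *ℕ 4 ^ p) * Δ             ≡⟨ cong (_* Δ) (trans (ℤₚ.pos-* 4 (4 ^ p)) (cong (+ 4 *_) (4^≡2^*2^ p))) ⟩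
  + 4 * (2^ p * 2^ p) * Δ        ≡⟨ ℤₚ.*-assoc (+ 4) (2^ p * 2^ p) Δ ⟩
  + 4 * (2^ p * 2^ p * Δ)        ∎)
  where
  open ≡-Reasoning
  expand : ∀ h a c → + 4 * (h * h - a * c) ≡ + 2 * h * (+ 2 * h) - + 4 * a * c
  expand = solve-∀

module QuadraticSequence (a b c Δ : ℤ) (p : ℕ) (a-odd : Odd a) (disc : b * b - + 4 * a * c ≡ + (4 ^ suc p) * Δ)
                         (h : ℤ) (b≡2h : b ≡ + 2 * h) where

  y : ℕ → ℤ
  y n = a * + n + h

  a*quad : ∀ x → a * quad a b c x ≡ (a * x + h) * (a * x + h) - 2^ p * 2^ p * Δ
  a*quad x = trans (cong (λ b → a * quad a b c x) b≡2h)
    (trans (complete-square a h c x)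
           (cong (λ D → (a * x + h) * (a * x + h) - D) (half-discriminant {a} {b} {c} {h} {Δ} p disc b≡2h)))
    where
    complete-square : ∀ a h c x → a * (a * x * x + + 2 * h * x + c) ≡ (a * x + h) * (a * x + h) - (h * h - a * c)
    complete-square = solve-∀

  Val2-quad : ∀ {n k} → Val2 (y n * y n - 2^ p * 2^ p * Δ) k → Val2 (quad a b c (+ n)) k
  Val2-quad {n} {k} v = Val2-cancel-odd {a} {quad a b c (+ n)} {k} a-odd (subst (λ z → Val2 z k) (sym (a*quad (+ n))) v)

  y-+ : ∀ n k → y (n +ℕ k) ≡ y n + a * + k
  y-+ n k = trans (cong (λ z → a * z + h) (ℤₚ.pos-+ n k)) (shift a (+ n) (+ k) h)
    where
    shift : ∀ a n k h → a * (n + k) + h ≡ (a * n + h) + a * k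
    shift = solve-∀

  y-+≡ : ∀ n k → y (n +ℕ k) - y n ≡ a * + k
  y-+≡ n k = trans (cong (_- y n) (y-+ n k)) (cancel (y n) (a * + k))
    where
    cancel : ∀ u v → u + v - u ≡ v
    cancel = solve-∀

  module Valuation {kₘ kₜ} (exponents : DiscValuations Δ kₘ kₜ) where
    open DiscValuations exponents

    ν : ℕ → ℕ
    ν n = weight kₘ kₜ (position p (y n))

    Val2-ν : ∀ n → Val2 (quad a b c (+ n)) (ν n)
    Val2-ν n = Val2-quad {n} {ν n} (Val2-square-sub {y n} {p} {kₘ} {kₜ} Δ Val2-1-Δ kₘ<3 Val2-Δ kₜ<2 (position p (y n)))

    ν-≤ : ∀ n → ν n ≤ 2 +ℕ 2 *ℕ p
    ν-≤ n = weight-≤ (ℕₚ.m<1+n⇒m≤n kₘ<3) (ℕₚ.<⇒≤ kₜ<2) (position p (y n))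

    ν-periodic : ∀ n → ν (n +ℕ 2 ^ suc p) ≡ ν n
    ν-periodic n = weight-resp-≡ kₘ kₜ y≡ (position p (y (n +ℕ 2 ^ suc p))) (position p (y n))
      where
      y≡ : y (n +ℕ 2 ^ suc p) ≡ y n [mod 2 ^ suc p ]
      y≡ = ≡-mod-intro {y (n +ℕ 2 ^ suc p)} {y n} a (trans (y-+≡ n (2 ^ suc p)) (ℤₚ.*-comm a (2^ suc p)))

    ν-minimal : ∀ q → 0 < q → q < 2 ^ suc p → ¬ (∀ n → ν (n +ℕ q) ≡ ν n)
    ν-minimal q 0<q q<2^p2 periodic = ℕₚ.<⇒≱ q<2^p2 (ℕᵈ.∣⇒≤ {{>-nonZero 0<q}} 2^p2∣q)
      where
      root : ∃[ n ] 2^ suc p ∣ y n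
      root = odd-linear-solvable {a} a-odd (suc p) h
      n₀ : ℕ
      n₀ = proj₁ root
      ν-root : ν n₀ ≡ kₜ +ℕ 2 *ℕ p
      ν-root = weight-resp-≡ kₘ kₜ (≡-mod-refl {y n₀}) (position p (y n₀)) (above (proj₂ root))
      2^p2∣y[n₀+q] : 2^ suc p ∣ y (n₀ +ℕ q)
      2^p2∣y[n₀+q] = weight≡⇒above kₘ≢kₜ (position p (y (n₀ +ℕ q))) (trans (periodic n₀) ν-root)
      2^p2∣aq : 2^ suc p ∣ a * + q
      2^p2∣aq = subst (2^ suc p ∣_) (y-+≡ n₀ q)
                      (∣m∣n⇒∣m-n {2^ suc p} {y (n₀ +ℕ q)} {y n₀} 2^p2∣y[n₀+q] (proj₂ root))
      2^p2∣q : 2 ^ suc p ℕᵈ.∣ q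
      2^p2∣q = 2^∣-cancel-odd {a} a-odd (suc p) {+ q} 2^p2∣aq

  module Formula {a⁻¹} (inv : a * a⁻¹ ≡ + 1 [mod 2 ^ suc p ]) (n : ℕ) where

    R≡y : ∀ {i R} → i ≤ suc p → + n ≡ a⁻¹ * (R - h) [mod 2 ^ i ] → R ≡ y n [mod 2 ^ i ]
    R≡y {i} {R} i≤p+1 n≡ = ≡-mod-sym {y n} {R}
      (linear-≡ {a} {a⁻¹} {+ n} {h} {R} (ℕᵈ.∣-trans (2^∣2^ i≤p+1) inv) n≡)

    Val2-quad-below : ∀ j → j < p → + n ≡ a⁻¹ * (2^ j - h) [mod 2 ^ suc j ] → Val2 (quad a b c (+ n)) (2 *ℕ j)
    Val2-quad-below j j<p n≡ = Val2-quad {n} {2 *ℕ j} (Val2-square-sub-below {y n} {j} {p} Δ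
      (Val2-resp-≡ {2^ j} {y n} (Val2-2^ j) (ℕₚ.n<1+n j) (R≡y {suc j} {2^ j} (s≤s (ℕₚ.<⇒≤ j<p)) n≡)) j<p)

    Val2-quad-at : ∀ {k} → Val2 (+ 1 - Δ) k → k < 3 → + n ≡ a⁻¹ * (2^ p - h) [mod 2 ^ suc p ] →
                   Val2 (quad a b c (+ n)) (k +ℕ 2 *ℕ p)
    Val2-quad-at {k} v1-Δ k<3 n≡ = Val2-quad {n} {k +ℕ 2 *ℕ p} (Val2-square-sub-at {y n} {p} {k} Δ
      (Val2-resp-≡ {2^ p} {y n} (Val2-2^ p) (ℕₚ.n<1+n p) (R≡y {suc p} {2^ p} ℕₚ.≤-refl n≡)) v1-Δ k<3)

    Val2-quad-above : ∀ {k} → Val2 Δ k → k < 2 → + n ≡ a⁻¹ * (2^ suc p - h) [mod 2 ^ suc p ] →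
                      Val2 (quad a b c (+ n)) (k +ℕ 2 *ℕ p)
    Val2-quad-above {k} vΔ k<2 n≡ = Val2-quad {n} {k +ℕ 2 *ℕ p} (Val2-square-sub-above {y n} {p} {k} Δ
      (∣-resp-≡-mod {2^ suc p} {y n} (R≡y {suc p} {2^ suc p} ℕₚ.≤-refl n≡) ℕᵈ.∣-refl) vΔ k<2)

theorem2 : (a b c Δ : ℤ) (ℓ m : ℕ) →
  ¬ ((+ 2) ∣ a) →
  (+ 2) ∣ b →
  b * b - (+ 4) * a * c ≡ (+ (4 ^ ℓ)) * Δ →
  ¬ ((+ (4 ^ suc ℓ)) ∣ (b * b - (+ 4) * a * c)) →
  2 ≤ ℓ →
  Δ ≡ (+ m) [mod 8 ] →
  (m ≡ 2 ⊎ m ≡ 3 ⊎ m ≡ 5 ⊎ m ≡ 6 ⊎ m ≡ 7) →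
  Σ (ℕ → ℕ) (λ v →
    (∀ n → Val2 (quad a b c (+ n)) (v n))
    × (∃ λ B → ∀ n → v n ≤ B)
    × (∀ n → v (n +ℕ 2 ^ ℓ) ≡ v n)
    × (∀ p → 0 < p → p < 2 ^ ℓ → ¬ (∀ n → v (n +ℕ p) ≡ v n)))
  × ((ainv h : ℤ) → a * ainv ≡ (+ 1) [mod 2 ^ ℓ ] → b ≡ (+ 2) * h → (n : ℕ) →
    ((+ n) ≡ ainv * ((+ 1) - h) [mod 2 ] → Val2 (quad a b c (+ n)) 0)
    × ((i : ℕ) → 2 ≤ i → i < ℓ → (+ n) ≡ ainv * ((+ (2 ^ (i ∸ 1))) - h) [mod 2 ^ i ] →
        Val2 (quad a b c (+ n)) (2 *ℕ (i ∸ 1)))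
    × ((+ n) ≡ ainv * ((+ (2 ^ (ℓ ∸ 1))) - h) [mod 2 ^ ℓ ] →
        ((m ≡ 2 ⊎ m ≡ 6) → Val2 (quad a b c (+ n)) (2 *ℕ (ℓ ∸ 1)))
        × ((m ≡ 3 ⊎ m ≡ 7) → Val2 (quad a b c (+ n)) (2 *ℕ ℓ ∸ 1))
        × (m ≡ 5 → Val2 (quad a b c (+ n)) (2 *ℕ ℓ)))
    × ((+ n) ≡ ainv * ((+ (2 ^ ℓ)) - h) [mod 2 ^ ℓ ] →
        ((m ≡ 2 ⊎ m ≡ 6) → Val2 (quad a b c (+ n)) (2 *ℕ ℓ ∸ 1))
        × ((m ≡ 3 ⊎ m ≡ 5 ⊎ m ≡ 7) → Val2 (quad a b c (+ n)) (2 *ℕ (ℓ ∸ 1)))))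
theorem2 a b c Δ (suc p) m a-odd 2∣b disc _ (s≤s 0<p) Δ≡m m-cases =
  (ν , Val2-ν , (2 +ℕ 2 *ℕ p , ν-≤) , ν-periodic , ν-minimal) ,
  λ a⁻¹ h′ inv b≡2h′ n → let open Sequence.Formula h′ b≡2h′ inv n in
    Val2-quad-below 0 0<p ,
    (λ { (suc j) _ (s≤s j<p) → Val2-quad-below j j<p }) ,
    (λ n≡ → let v = Val2-quad-at Val2-1-Δ kₘ<3 n≡ in
      [ specialise ν₂[1-m] n refl v , specialise ν₂[1-m] n refl v ]′ ,
      [ specialise ν₂[1-m] n 2ℓ∸1 v , specialise ν₂[1-m] n 2ℓ∸1 v ]′ ,
      specialise ν₂[1-m] n 2ℓ v) ,
    (λ n≡ → let v = Val2-quad-above Val2-Δ kₜ<2 n≡ in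
      [ specialise ν₂[m] n 2ℓ∸1 v , specialise ν₂[m] n 2ℓ∸1 v ]′ ,
      [ specialise ν₂[m] n refl v , [ specialise ν₂[m] n refl v , specialise ν₂[m] n refl v ]′ ]′)
  where
  exponents : DiscValuations Δ (ν₂[1-m] m) (ν₂[m] m)
  exponents = DiscValuations-resp-≡ {+ m} {Δ} (≡-mod-sym {Δ} {+ m} Δ≡m) (residue-valuations m-cases)
  open DiscValuations exponents
  b-even : + 2 Signed.∣ b
  b-even = Signed.∣ᵤ⇒∣ {+ 2} {b} 2∣b
  b≡2h : b ≡ + 2 * Signed.quotient b-even
  b≡2h = trans (Signed._∣_.equality b-even) (ℤₚ.*-comm (Signed.quotient b-even) (+ 2))
  module Sequence = QuadraticSequence a b c Δ p a-odd disc
  open Sequence.Valuation (Signed.quotient b-even) b≡2h exponents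
  2ℓ∸1 : suc (2 *ℕ p) ≡ 2 *ℕ suc p ∸ 1
  2ℓ∸1 = cong (_∸ 1) (sym (ℕₚ.*-suc 2 p))
  2ℓ : suc (suc (2 *ℕ p)) ≡ 2 *ℕ suc p
  2ℓ = sym (ℕₚ.*-suc 2 p)
  specialise : ∀ (ν₂ : ℕ → ℕ) n {m′ j} → ν₂ m′ +ℕ 2 *ℕ p ≡ j →
               Val2 (quad a b c (+ n)) (ν₂ m +ℕ 2 *ℕ p) → m ≡ m′ → Val2 (quad a b c (+ n)) j
  specialise ν₂ n eq v refl = subst (Val2 (quad a b c (+ n))) eq v
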